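{- For any even integer $k \ge 2$ and any prime $p \ge k + 2$, the circulant graph $\mathrm{Circ}(2p, \{1, 2, \ldots, k\})$ is a Cayley nut graph $G$ with $o_e(G) = k$ and $o_a(G) = k$.
   Context: All graphs are finite, simple and undirected. For $S \subseteq \{1, \ldots, \lfloor n/2 \rfloor\}$, $\mathrm{Circ}(n,S)$ is the graph on vertex set $\mathbb{Z}_n$ in which $u$ and $v$ are adjacent iff $u - v \in S$ or $v - u \in S$ (computed in $\mathbb{Z}_n$). A nut graph is a graph with at least two vertices whose adjacency matrix has a one-dimensional null space spanned by a vector with no zero entries. For a graph $G$, $o_e(G)$ and $o_a(G)$ denote the number of orbits of $\mathrm{Aut}\,G$ on the edge set and on the arc set (ordered pairs of adjacent vertices), respectively. A Cayley graph is a graph of the form $\mathrm{Cay}(\Gamma,S)$ for a group $\Gamma$ and inverse-closed $S\subseteq\Gamma\setminus\{e\}$, with $g\sim h$ iff $g^{ -1}h\in S$.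
   Formalization: The null space of the adjacency matrix in the nut-graph condition is taken over ℚ, so the kernel vectors have rational entries. -}

module Defs where

open import Data.Bool using (Bool; true; false; _∧_; _∨_; if_then_else_)
open import Data.Nat using (ℕ; zero; suc; _+_; _*_; _∸_; _≤ᵇ_)
open import Data.Nat.DivMod using (_%_)
open import Data.Fin using (Fin; toℕ)
import Data.Fin as F
open import Data.Rational using (ℚ; 0ℚ; 1ℚ)
import Data.Rational as Q
open import Data.Product using (Σ; ∃; _×_; _,_)
open import Data.Sum using (_⊎_)
open import Data.Empty using (⊥)
open import Relation.Nullary using (¬_)
open import Relation.Binary.PropositionalEquality using (_≡_; _≢_)
open import Data.Fin.Permutation using (Permutation′; _⟨$⟩ʳ_)
open import Algebra.Structures using (IsGroup)

Graph : ℕ → Set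
Graph n = Fin n → Fin n → Bool

-- (u - v) mod n, as a natural number in {0,…,n-1}; vertex i of Fin n is i ∈ ℤ_n.
diffMod : ∀ {n} → Fin n → Fin n → ℕ
diffMod {suc m} u v = (toℕ u + (suc m ∸ toℕ v)) % suc m

Circ : (n : ℕ) → (ℕ → Bool) → Graph n
Circ n S u v = S (diffMod u v) ∨ S (diffMod v u)

upToSet : ℕ → ℕ → Bool
upToSet k d = (1 ≤ᵇ d) ∧ (d ≤ᵇ k)

sumℚ : ∀ {n} → (Fin n → ℚ) → ℚ
sumℚ {zero}  f = 0ℚ
sumℚ {suc n} f = f F.zero Q.+ sumℚ (λ i → f (F.suc i))

A[_] : ∀ {n} → Graph n → Fin n → Fin n → ℚ
A[ G ] u v = if G u v then 1ℚ else 0ℚ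

InKernel : ∀ {n} → Graph n → (Fin n → ℚ) → Set
InKernel {n} G x = ∀ u → sumℚ (λ v → A[ G ] u v Q.* x v) ≡ 0ℚ

IsNut : ∀ {n} → Graph n → Set
IsNut {n} G =
  (2 Data.Nat.≤ n) ×
  Σ (Fin n → ℚ) λ x →
    InKernel G x ×
    (∀ v → x v ≢ 0ℚ) ×
    (∀ y → InKernel G y → Σ ℚ λ c → ∀ v → y v ≡ c Q.* x v)

IsAut : ∀ {n} → Graph n → Permutation′ n → Set
IsAut {n} G σ = ∀ u v → G (σ ⟨$⟩ʳ u) (σ ⟨$⟩ʳ v) ≡ G u v

IsArc : ∀ {n} → Graph n → Fin n × Fin n → Set
IsArc G (u , v) = G u v ≡ true

ArcRel : ∀ {n} → Graph n → Fin n × Fin n → Fin n × Fin n → Set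
ArcRel {n} G (u , v) (u' , v') =
  Σ (Permutation′ n) λ σ → IsAut G σ × (σ ⟨$⟩ʳ u ≡ u') × (σ ⟨$⟩ʳ v ≡ v')

-- same Aut-orbit on edges; an edge {u,v} is represented by either of
-- its ordered pairs, and the image may be matched in either orientation
EdgeRel : ∀ {n} → Graph n → Fin n × Fin n → Fin n × Fin n → Set
EdgeRel {n} G (u , v) (u' , v') =
  Σ (Permutation′ n) λ σ → IsAut G σ ×
    (((σ ⟨$⟩ʳ u ≡ u') × (σ ⟨$⟩ʳ v ≡ v')) ⊎ ((σ ⟨$⟩ʳ u ≡ v') × (σ ⟨$⟩ʳ v ≡ u')))

NumClasses : {A : Set} → (A → Set) → (A → A → Set) → ℕ → Set
NumClasses {A} P R m =
  Σ (Fin m → A) λ r →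
    (∀ i → P (r i)) ×
    (∀ i j → R (r i) (r j) → i ≡ j) ×
    (∀ a → P a → Σ (Fin m) λ i → R a (r i))

EdgeOrbits : ∀ {n} → Graph n → ℕ → Set
EdgeOrbits G m = NumClasses (IsArc G) (EdgeRel G) m

ArcOrbits : ∀ {n} → Graph n → ℕ → Set
ArcOrbits G m = NumClasses (IsArc G) (ArcRel G) m

-- Cayley graphs (up to isomorphism: the group is put on the vertex set)

IsCayley : ∀ {n} → Graph n → Set
IsCayley {n} G =
  Σ (Fin n → Fin n → Fin n) λ _∙_ →
  Σ (Fin n) λ e →
  Σ (Fin n → Fin n) λ inv →
    IsGroup _≡_ _∙_ e inv ×
    Σ (Fin n → Bool) λ S →
      (∀ g → S (inv g) ≡ S g) ×
      (S e ≡ false) ×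
      (∀ g h → G g h ≡ S (inv g ∙ h))

module Submission where

-- The graph is the Cayley graph of ℤ₂ₚ with connection set ±{1, …, k}.
--
-- Translations x ↦ x + c and reflections x ↦ c − x are automorphisms, and they carry
-- every arc to one of the k arcs (0, d) with 1 ≤ d ≤ k. These lie in different edge orbits: an
-- edge {u, u + d} has at most one private neighbour (a neighbour of u that is neither equal nor
-- adjacent to u + d) exactly when d = 1. So every automorphism maps the Hamiltonian cycle
-- 0, 1, 2, … onto itself, is therefore of the form x ↦ c ± x, and sends {0, d} to {0, d′} only
-- if d′ = d.
--
-- With the window sums L(b) = y_b + ⋯ + y_(b+k−1), the equation at vertex a + k reads
-- L(a) + L(a + k + 1) = 0. Hence Δ(a) = y_(a+k) − y_a = L(a + 1) − L(a) changes sign under a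
-- shift by k + 1; as it also has period 2p and gcd(k + 1, p) = 1, Δ has period 2, hence period
-- k, and then y_(a+pk) = y_a + pΔ(a) forces Δ = 0. Now y has the periods k and 2p, and
-- gcd(k/2, p) = 1, so y has period 2, and one more equation gives y₁ = −y₀: the kernel is
-- spanned by ((−1)^i), which has no zero entry.

open import Algebra.Bundles using (AbelianGroup)
open import Algebra.Structures using (IsAbelianGroup)
import Algebra.Properties.AbelianGroup as AbelianGroupProperties
open import Data.Bool using (Bool; true; false; _∨_; if_then_else_)
open import Data.Bool.Properties using (T-≡; ∨-comm; ∨-zeroʳ)
open import Data.Empty using (⊥-elim)
open import Data.Fin using (Fin; zero; suc; toℕ; fromℕ<)
open import Data.Fin.Permutation using (Permutation′; permutation; _⟨$⟩ʳ_; _⟨$⟩ˡ_)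
import Data.Fin.Permutation as Permutation
open import Data.Fin.Properties using (toℕ-injective; toℕ-fromℕ<; toℕ<n)
open import Data.Nat using (ℕ; zero; suc; _+_; _*_; _∸_; _<_; _≤_; _<ᵇ_; z≤n; s≤s; z<s; >-nonZero)
open import Data.Nat.Coprimality using (Coprime; coprime-Bézout; prime⇒coprime)
import Data.Nat.Coprimality as Coprimality
open import Data.Nat.Divisibility using (_∣_; divides)
open import Data.Nat.DivMod
  using (_%_; _/_; _mod_; m%n<n; m<n⇒m%n≡m; %-distribˡ-+; n%n≡0; m≡m%n+[m/n]*n)
open import Data.Nat.GCD using (module Bézout)
open import Data.Nat.Primality using (Prime)
open import Data.Nat.Properties
  using (+-comm; +-assoc; +-suc; +-identityʳ; +-cancelˡ-≡; *-assoc; *-comm; suc-injective;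
         0≢1+n; 1+n≢0; 1+n≢n; n≢0⇒n>0; ≤-refl; ≤-trans; <-trans; ≤-<-trans; <⇒≤; <⇒≱; ≤⇒≯;
         n≤1+n; n<1+n; m≤m+n; m≤n+m; m≤m*n; +-mono-≤; +-monoʳ-≤; +-monoʳ-<; +-monoˡ-<;
         *-monoˡ-≤; m∸n+n≡m; m∸n≤m; m<n⇒0<n∸m; +-∸-comm; [m+n]∸[m+o]≡n∸o; <⇒<ᵇ; <ᵇ⇒<;
         m≤n⇒∃[o]m+o≡n)
import Data.Nat.Solver as ℕ-Solver
open import Data.Product using (Σ; _×_; _,_; map₂)
open import Data.Rational using (ℚ; 0ℚ; 1ℚ)
import Data.Rational as ℚ
import Data.Rational.Properties as ℚ
import Data.Rational.Solver as ℚ-Solver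
open import Data.Sum using (_⊎_; inj₁; inj₂; swap)
open import Function using (_∘_; flip)
open import Function.Bundles using (Equivalence)
open import Relation.Binary.Definitions using (tri<; tri≈; tri>)
open import Relation.Binary.PropositionalEquality hiding ([_])
open import Relation.Nullary using (¬_; contradiction)
open import Algebra.Properties.CommutativeMonoid.Sum ℚ.+-0-commutativeMonoid
  using (sum; sum-permute; sum-cong-≗)
open import Algebra.Properties.Monoid.Mult ℚ.+-0-monoid using (×-homo-+) renaming (_×_ to _·_)
open import Algebra.Properties.Group ℚ.+-0-group using (inverseʳ-unique; identityʳ-unique)

open import Defs

∨≡true : ∀ a b → a ∨ b ≡ true → a ≡ true ⊎ b ≡ true
∨≡true true  _ _  = inj₁ refl
∨≡true false _ eq = inj₂ eq

true≢false : true ≢ false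
true≢false ()

<ᵇ-true : ∀ {i k} → i < k → (i <ᵇ k) ≡ true
<ᵇ-true i<k = Equivalence.to T-≡ (<⇒<ᵇ i<k)

<ᵇ-false : ∀ {i k} → k ≤ i → (i <ᵇ k) ≡ false
<ᵇ-false {i} {k} k≤i with i <ᵇ k in eq
... | false = refl
... | true  = contradiction (<ᵇ⇒< i k (Equivalence.from T-≡ eq)) (≤⇒≯ k≤i)

upToSet-true : ∀ {k d} → 1 ≤ d → d ≤ k → upToSet k d ≡ true
upToSet-true (s≤s z≤n) d≤k = <ᵇ-true d≤k

upToSet-false : ∀ {k d} → k < d → upToSet k d ≡ false
upToSet-false {d = suc d} (s≤s k≤d) = <ᵇ-false k≤d

upToSet-inv : ∀ {k} d → upToSet k d ≡ true → Σ ℕ λ i → i < k × d ≡ suc i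
upToSet-inv {k} (suc i) eq = i , <ᵇ⇒< i k (Equivalence.from T-≡ eq) , refl

data Split (a b : ℕ) : ℕ → Set where
  left  : ∀ {t} → t < a → Split a b t
  right : ∀ {i} → i < b → Split a b (a + i)

split : ∀ a {b t} → t < a + b → Split a b t
split zero    t<b = right t<b
split (suc a) {t = zero}  _ = left z<s
split (suc a) {t = suc t} (s≤s t<a+b) with split a t<a+b
... | left t<a  = left (s≤s t<a)
... | right i<b = right i<b

-- Periodic sequences and window sums over ℚ

Periodic : ∀ {A : Set} → ℕ → (ℕ → A) → Set
Periodic P h = ∀ a → h (P + a) ≡ h a

periodic-* : ∀ {A : Set} {P} {h : ℕ → A} → Periodic P h → ∀ t → Periodic (t * P) h
periodic-* per zero    a = refl
periodic-* {P = P} {h} per (suc t) a =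
  trans (cong h (+-assoc P (t * P) a)) (trans (per (t * P + a)) (periodic-* per t a))

periodic-shift : ∀ {A : Set} {P} {h : ℕ → A} → Periodic P h → ∀ b → Periodic P (λ t → h (b + t))
periodic-shift {P = P} {h} per b t = begin
  h (b + (P + t))  ≡⟨ cong h (sym (+-assoc b P t)) ⟩
  h (b + P + t)    ≡⟨ cong (λ z → h (z + t)) (+-comm b P) ⟩
  h (P + b + t)    ≡⟨ cong h (+-assoc P b t) ⟩
  h (P + (b + t))  ≡⟨ per (b + t) ⟩
  h (b + t)        ∎
  where open ≡-Reasoning

periodic-combination : ∀ {A : Set} {P Q d x y} {h : ℕ → A} →
                       Periodic P h → Periodic Q h → d + y * Q ≡ x * P → Periodic d h
periodic-combination {P = P} {Q} {d} {x} {y} {h} per-P per-Q eq a = begin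
  h (d + a)            ≡⟨ periodic-* per-Q y (d + a) ⟨
  h (y * Q + (d + a))  ≡⟨ cong h (sym (+-assoc (y * Q) d a)) ⟩
  h (y * Q + d + a)    ≡⟨ cong (λ z → h (z + a)) (trans (+-comm (y * Q) d) eq) ⟩
  h (x * P + a)        ≡⟨ periodic-* per-P x a ⟩
  h a                  ∎
  where open ≡-Reasoning

period-2 : ∀ {A : Set} {c p} {h : ℕ → A} → Coprime c p →
           Periodic (c * 2) h → Periodic (p * 2) h → Periodic 2 h
period-2 {c = c} {p} {h} coprime per-c per-p = from-identity (coprime-Bézout coprime)
  where
  open ℕ-Solver.+-*-Solver using (solve; _:+_; _:*_; _:=_; con)
  doubled : ∀ a b x y → 1 + y * b ≡ x * a → 2 + y * (b * 2) ≡ x * (a * 2)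
  doubled a b x y eq = begin
    2 + y * (b * 2)
      ≡⟨ solve 2 (λ b y → con 2 :+ y :* (b :* con 2) := (con 1 :+ y :* b) :* con 2) refl b y ⟩
    (1 + y * b) * 2  ≡⟨ cong (_* 2) eq ⟩
    x * a * 2        ≡⟨ *-assoc x a 2 ⟩
    x * (a * 2)      ∎
    where open ≡-Reasoning
  from-identity : Bézout.Identity 1 c p → Periodic 2 h
  from-identity (Bézout.+- x y eq) = periodic-combination {x = x} {y} per-c per-p (doubled c p x y eq)
  from-identity (Bézout.-+ x y eq) = periodic-combination {x = y} {x} per-p per-c (doubled p c y x eq)

∑< : ℕ → (ℕ → ℚ) → ℚ
∑< n f = sum {n} (λ i → f (toℕ i))

∑<-cong : ∀ n {f g : ℕ → ℚ} → (∀ {t} → t < n → f t ≡ g t) → ∑< n f ≡ ∑< n g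
∑<-cong zero    _   = refl
∑<-cong (suc n) f≡g = cong₂ ℚ._+_ (f≡g z<s) (∑<-cong n (f≡g ∘ s≤s))

∑<-+ : ∀ a b f → ∑< (a + b) f ≡ ∑< a f ℚ.+ ∑< b (λ t → f (a + t))
∑<-+ zero    b f = sym (ℚ.+-identityˡ _)
∑<-+ (suc a) b f = trans (cong (f 0 ℚ.+_) (∑<-+ a b (f ∘ suc))) (sym (ℚ.+-assoc (f 0) _ _))

∑<-zero : ∀ n {f} → (∀ {t} → t < n → f t ≡ 0ℚ) → ∑< n f ≡ 0ℚ
∑<-zero zero    _   = refl
∑<-zero (suc n) f≡0 =
  trans (cong₂ ℚ._+_ (f≡0 z<s) (∑<-zero n (f≡0 ∘ s≤s))) (ℚ.+-identityˡ 0ℚ)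

∑<-last : ∀ n f → ∑< (suc n) f ≡ ∑< n f ℚ.+ f n
∑<-last zero    f = trans (ℚ.+-identityʳ (f 0)) (sym (ℚ.+-identityˡ (f 0)))
∑<-last (suc n) f = trans (cong (f 0 ℚ.+_) (∑<-last n (f ∘ suc))) (sym (ℚ.+-assoc (f 0) _ _))

∑<-2-periodic : ∀ j {f} → Periodic 2 f → ∑< (j * 2) f ≡ j · (f 0 ℚ.+ f 1)
∑<-2-periodic zero    _   = refl
∑<-2-periodic (suc j) {f} per = begin
  f 0 ℚ.+ (f 1 ℚ.+ ∑< (j * 2) (λ t → f (2 + t)))
    ≡⟨ ℚ.+-assoc (f 0) (f 1) _ ⟨
  f 0 ℚ.+ f 1 ℚ.+ ∑< (j * 2) (λ t → f (2 + t))
    ≡⟨ cong (f 0 ℚ.+ f 1 ℚ.+_) (∑<-cong (j * 2) (λ {t} _ → per t)) ⟩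
  f 0 ℚ.+ f 1 ℚ.+ ∑< (j * 2) f
    ≡⟨ cong (f 0 ℚ.+ f 1 ℚ.+_) (∑<-2-periodic j per) ⟩
  f 0 ℚ.+ f 1 ℚ.+ j · (f 0 ℚ.+ f 1)
    ∎
  where open ≡-Reasoning

·-zero : ∀ t → t · 0ℚ ≡ 0ℚ
·-zero zero    = refl
·-zero (suc t) = trans (ℚ.+-identityˡ (t · 0ℚ)) (·-zero t)

·-positive : ∀ t {q} → 0ℚ ℚ.< q → 0ℚ ℚ.< suc t · q
·-positive zero    0<q = subst (0ℚ ℚ.<_) (sym (ℚ.+-identityʳ _)) 0<q
·-positive (suc t) {q} 0<q =
  subst (ℚ._< suc (suc t) · q) (ℚ.+-identityˡ 0ℚ) (ℚ.+-mono-<-≤ 0<q (ℚ.<⇒≤ (·-positive t 0<q)))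

·-negative : ∀ t {q} → q ℚ.< 0ℚ → suc t · q ℚ.< 0ℚ
·-negative zero    q<0 = subst (ℚ._< 0ℚ) (sym (ℚ.+-identityʳ _)) q<0
·-negative (suc t) {q} q<0 =
  subst (suc (suc t) · q ℚ.<_) (ℚ.+-identityˡ 0ℚ) (ℚ.+-mono-<-≤ q<0 (ℚ.<⇒≤ (·-negative t q<0)))

·-cancel : ∀ {t q} → 0 < t → t · q ≡ 0ℚ → q ≡ 0ℚ
·-cancel {suc t} {q} _ tq≡0 with ℚ.<-cmp q 0ℚ
... | tri< q<0 _ _ = ⊥-elim (ℚ.<-irrefl tq≡0 (·-negative t q<0))
... | tri≈ _ q≡0 _ = q≡0
... | tri> _ _ q>0 = ⊥-elim (ℚ.<-irrefl (sym tq≡0) (·-positive t q>0))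

alternating : ℕ → ℚ
alternating zero          = 1ℚ
alternating (suc zero)    = ℚ.- 1ℚ
alternating (suc (suc t)) = alternating t

alternating-periodic : Periodic 2 alternating
alternating-periodic _ = refl

alternating-cancels : ∀ t → alternating t ℚ.+ alternating (suc t) ≡ 0ℚ
alternating-cancels zero          = refl
alternating-cancels (suc zero)    = refl
alternating-cancels (suc (suc t)) = alternating-cancels t

alternating-nonzero : ∀ t → alternating t ≢ 0ℚ
alternating-nonzero zero          ()
alternating-nonzero (suc zero)    ()
alternating-nonzero (suc (suc t)) = alternating-nonzero t

module Windows (k : ℕ) (Y : ℕ → ℚ) where

  open ℚ-Solver.+-*-Solver using (solve; _:+_; _:-_; _:*_; :-_; _:=_; con)

  window : ℕ → ℚ
  window b = ∑< k (λ s → Y (b + s))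

  Δ : ℕ → ℚ
  Δ a = Y (k + a) ℚ.- Y a

  Y-step : ∀ b → Y (k + b) ≡ Y b ℚ.+ Δ b
  Y-step b = solve 2 (λ y′ y → y′ := y :+ (y′ :- y)) refl (Y (k + b)) (Y b)

  window-suc : ∀ b → window (suc b) ≡ window b ℚ.+ Δ b
  window-suc b = begin
    window (suc b)
      ≡⟨ solve 2 (λ w y → w := y :+ w :- y) refl (window (suc b)) (Y b) ⟩
    Y b ℚ.+ window (suc b) ℚ.- Y b
      ≡⟨ cong (ℚ._- Y b) extend ⟩
    window b ℚ.+ Y (k + b) ℚ.- Y b
      ≡⟨ solve 3 (λ w y′ y → w :+ y′ :- y := w :+ (y′ :- y)) refl (window b) (Y (k + b)) (Y b) ⟩
    window b ℚ.+ Δ b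
      ∎
    where
    open ≡-Reasoning
    extend : Y b ℚ.+ window (suc b) ≡ window b ℚ.+ Y (k + b)
    extend = begin
      Y b ℚ.+ window (suc b)
        ≡⟨ cong₂ ℚ._+_ (cong Y (sym (+-identityʳ b))) (∑<-cong k (λ {s} _ → cong Y (sym (+-suc b s)))) ⟩
      ∑< (suc k) (λ s → Y (b + s))  ≡⟨ ∑<-last k (λ s → Y (b + s)) ⟩
      window b ℚ.+ Y (b + k)        ≡⟨ cong (λ z → window b ℚ.+ Y z) (+-comm b k) ⟩
      window b ℚ.+ Y (k + b)        ∎

  module _ (recurrence : ∀ a → window a ℚ.+ window (suc k + a) ≡ 0ℚ) where

    Δ-antiperiodic : ∀ a → Δ (suc k + a) ≡ ℚ.- Δ a
    Δ-antiperiodic a = inverseʳ-unique (Δ a) Δ′ (begin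
      Δ a ℚ.+ Δ′
        ≡⟨ solve 4 (λ l l′ d d′ → d :+ d′ := l :+ d :+ (l′ :+ d′) :- (l :+ l′)) refl L L′ (Δ a) Δ′ ⟩
      L ℚ.+ Δ a ℚ.+ (L′ ℚ.+ Δ′) ℚ.- (L ℚ.+ L′)
        ≡⟨ cong₂ (λ x x′ → x ℚ.+ x′ ℚ.- (L ℚ.+ L′)) (window-suc a) (window-suc (suc k + a)) ⟨
      window (suc a) ℚ.+ window (suc (suc k + a)) ℚ.- (L ℚ.+ L′)
        ≡⟨ cong (λ z → window (suc a) ℚ.+ window z ℚ.- (L ℚ.+ L′)) (+-suc (suc k) a) ⟨
      window (suc a) ℚ.+ window (suc k + suc a) ℚ.- (L ℚ.+ L′)
        ≡⟨ cong₂ ℚ._-_ (recurrence (suc a)) (recurrence a) ⟩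
      0ℚ                                                   ∎)
      where
      open ≡-Reasoning
      L L′ Δ′ : ℚ
      L  = window a
      L′ = window (suc k + a)
      Δ′ = Δ (suc k + a)

    module _ {j p : ℕ} (k≡j*2 : k ≡ j * 2) (0<j : 0 < j) (0<p : 0 < p)
             (coprime-suc-k : Coprime (suc k) p) (coprime-j : Coprime j p)
             (Y-periodic : Periodic (p * 2) Y) where

      open ℕ-Solver.+-*-Solver using ()
        renaming (solve to ℕ-solve; _:+_ to _ℕ+_; _:*_ to _ℕ*_; _:=_ to _ℕ=_; con to ℕcon)

      Δ-periodic-2 : Periodic 2 Δ
      Δ-periodic-2 = period-2 coprime-suc-k twice-suc-k twice-p
        where
        twice-suc-k : Periodic (suc k * 2) Δ
        twice-suc-k a = begin
          Δ (suc k * 2 + a)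
            ≡⟨ cong Δ (double (suc k) a) ⟩
          Δ (suc k + (suc k + a))  ≡⟨ Δ-antiperiodic (suc k + a) ⟩
          ℚ.- Δ (suc k + a)        ≡⟨ cong ℚ.-_ (Δ-antiperiodic a) ⟩
          ℚ.- (ℚ.- Δ a)            ≡⟨ solve 1 (λ d → :- (:- d) := d) refl (Δ a) ⟩
          Δ a                      ∎
          where
          open ≡-Reasoning
          double : ∀ x a → x * 2 + a ≡ x + (x + a)
          double = ℕ-solve 2 (λ x a → x ℕ* ℕcon 2 ℕ+ a ℕ= x ℕ+ (x ℕ+ a)) refl
        twice-p : Periodic (p * 2) Δ
        twice-p a = cong₂ ℚ._-_ (periodic-shift Y-periodic k a) (Y-periodic a)

      Δ-periodic-k : Periodic k Δ
      Δ-periodic-k = subst (λ m → Periodic m Δ) (sym k≡j*2) (periodic-* Δ-periodic-2 j)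

      Y-progression : ∀ t a → Y (t * k + a) ≡ Y a ℚ.+ t · Δ a
      Y-progression zero    a = sym (ℚ.+-identityʳ (Y a))
      Y-progression (suc t) a = begin
        Y (k + t * k + a)
          ≡⟨ cong Y (+-assoc k (t * k) a) ⟩
        Y (k + (t * k + a))
          ≡⟨ Y-step (t * k + a) ⟩
        Y (t * k + a) ℚ.+ Δ (t * k + a)
          ≡⟨ cong₂ ℚ._+_ (Y-progression t a) (periodic-* Δ-periodic-k t a) ⟩
        Y a ℚ.+ t · Δ a ℚ.+ Δ a
          ≡⟨ solve 3 (λ y s d → y :+ s :+ d := y :+ (d :+ s)) refl (Y a) (t · Δ a) (Δ a) ⟩
        Y a ℚ.+ suc t · Δ a
          ∎
        where open ≡-Reasoning

      Δ≡0 : ∀ a → Δ a ≡ 0ℚ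
      Δ≡0 a = ·-cancel 0<p (identityʳ-unique (Y a) (p · Δ a) (begin
        Y a ℚ.+ p · Δ a      ≡⟨ Y-progression p a ⟨
        Y (p * k + a)        ≡⟨ cong (λ m → Y (m + a)) p*k≡j*[p*2] ⟩
        Y (j * (p * 2) + a)  ≡⟨ periodic-* Y-periodic j a ⟩
        Y a                  ∎))
        where
        open ≡-Reasoning
        p*k≡j*[p*2] : p * k ≡ j * (p * 2)
        p*k≡j*[p*2] = trans (cong (p *_) k≡j*2)
                            (ℕ-solve 2 (λ p j → p ℕ* (j ℕ* ℕcon 2) ℕ= j ℕ* (p ℕ* ℕcon 2)) refl p j)

      Y-periodic-k : Periodic k Y
      Y-periodic-k a = trans (Y-step a) (trans (cong (Y a ℚ.+_) (Δ≡0 a)) (ℚ.+-identityʳ (Y a)))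

      Y-periodic-2 : Periodic 2 Y
      Y-periodic-2 = period-2 coprime-j (subst (λ m → Periodic m Y) k≡j*2 Y-periodic-k) Y-periodic

      window-pairs : ∀ b → window b ≡ j · (Y b ℚ.+ Y (suc b))
      window-pairs b = begin
        ∑< k (λ s → Y (b + s))
          ≡⟨ cong (λ m → ∑< m (λ s → Y (b + s))) k≡j*2 ⟩
        ∑< (j * 2) (λ s → Y (b + s))
          ≡⟨ ∑<-2-periodic j (periodic-shift Y-periodic-2 b) ⟩
        j · (Y (b + 0) ℚ.+ Y (b + 1))
          ≡⟨ cong₂ (λ x y → j · (Y x ℚ.+ Y y)) (+-identityʳ b) (+-comm b 1) ⟩
        j · (Y b ℚ.+ Y (suc b))
          ∎
        where open ≡-Reasoning

      Y0+Y1≡0 : Y 0 ℚ.+ Y 1 ≡ 0ℚ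
      Y0+Y1≡0 = ·-cancel (≤-trans 0<j (m≤m+n j j)) (begin
        (j + j) · (Y 0 ℚ.+ Y 1)                  ≡⟨ ×-homo-+ (Y 0 ℚ.+ Y 1) j j ⟩
        j · (Y 0 ℚ.+ Y 1) ℚ.+ j · (Y 0 ℚ.+ Y 1)  ≡⟨ cong₂ ℚ._+_ (window-pairs 0) window[1+k] ⟨
        window 0 ℚ.+ window (suc k)              ≡⟨ cong (λ m → window 0 ℚ.+ window m) (+-identityʳ (suc k)) ⟨
        window 0 ℚ.+ window (suc k + 0)          ≡⟨ recurrence 0 ⟩
        0ℚ                                       ∎)
        where
        open ≡-Reasoning
        window[1+k] : window (suc k) ≡ j · (Y 0 ℚ.+ Y 1)
        window[1+k] = begin
          window (suc k)                  ≡⟨ window-pairs (suc k) ⟩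
          j · (Y (1 + k) ℚ.+ Y (2 + k))   ≡⟨ cong₂ (λ y₁ y₀ → j · (y₁ ℚ.+ y₀)) (Y-periodic-k′ 1) (Y-periodic-k′ 2) ⟩
          j · (Y 1 ℚ.+ Y 2)               ≡⟨ cong (λ y₀ → j · (Y 1 ℚ.+ y₀)) (Y-periodic-2 0) ⟩
          j · (Y 1 ℚ.+ Y 0)               ≡⟨ cong (j ·_) (ℚ.+-comm (Y 1) (Y 0)) ⟩
          j · (Y 0 ℚ.+ Y 1)               ∎
          where
          Y-periodic-k′ : ∀ a → Y (a + k) ≡ Y a
          Y-periodic-k′ a = trans (cong Y (+-comm a k)) (Y-periodic-k a)

      Y-alternates : ∀ t → Y t ≡ Y 0 ℚ.* alternating t
      Y-alternates zero          = sym (ℚ.*-identityʳ (Y 0))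
      Y-alternates (suc zero)    = trans (inverseʳ-unique (Y 0) (Y 1) Y0+Y1≡0)
                                         (solve 1 (λ y → :- y := y :* (:- con 1ℚ)) refl (Y 0))
      Y-alternates (suc (suc t)) = trans (Y-periodic-2 t) (Y-alternates t)

-- Automorphism invariants of graphs

permutation-injective : ∀ {n} (σ : Permutation′ n) {x y} → σ ⟨$⟩ʳ x ≡ σ ⟨$⟩ʳ y → x ≡ y
permutation-injective σ eq =
  trans (sym (Permutation.inverseˡ σ)) (trans (cong (σ ⟨$⟩ˡ_) eq) (Permutation.inverseˡ σ))

ArcRel⇒EdgeRel : ∀ {n} {G : Graph n} {a b} → ArcRel G a b → EdgeRel G a b
ArcRel⇒EdgeRel (σ , σ-aut , eq₁ , eq₂) = σ , σ-aut , inj₁ (eq₁ , eq₂)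

module PrivateNeighbours {n} (G : Graph n) where

  PrivateNeighbour : Fin n → Fin n → Fin n → Set
  PrivateNeighbour u v w = G u w ≡ true × w ≢ v × G v w ≡ false

  AtMostOnePrivate : Fin n → Fin n → Set
  AtMostOnePrivate u v = ∀ {w w′} → PrivateNeighbour u v w → PrivateNeighbour u v w′ → w ≡ w′

  module _ (σ : Permutation′ n) (σ-aut : IsAut G σ) where

    private
      σ⁻¹ : Fin n → Fin n
      σ⁻¹ = σ ⟨$⟩ˡ_

      pullback : ∀ {u v w} → PrivateNeighbour (σ ⟨$⟩ʳ u) (σ ⟨$⟩ʳ v) w → PrivateNeighbour u v (σ⁻¹ w)
      pullback {u} {v} {w} (uw , w≢v , vw) =
        trans (sym (σ-aut u (σ⁻¹ w))) (trans (cong (G _) (Permutation.inverseʳ σ)) uw) ,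
        (λ eq → w≢v (trans (sym (Permutation.inverseʳ σ)) (cong (σ ⟨$⟩ʳ_) eq))) ,
        trans (sym (σ-aut v (σ⁻¹ w))) (trans (cong (G _) (Permutation.inverseʳ σ)) vw)

    isAut-AtMostOnePrivate : ∀ {u v} → AtMostOnePrivate u v → AtMostOnePrivate (σ ⟨$⟩ʳ u) (σ ⟨$⟩ʳ v)
    isAut-AtMostOnePrivate unique {w} {w′} pw pw′ = begin
      w                 ≡⟨ Permutation.inverseʳ σ ⟨
      σ ⟨$⟩ʳ (σ⁻¹ w)    ≡⟨ cong (σ ⟨$⟩ʳ_) (unique (pullback pw) (pullback pw′)) ⟩
      σ ⟨$⟩ʳ (σ⁻¹ w′)   ≡⟨ Permutation.inverseʳ σ ⟩
      w′                ∎
      where open ≡-Reasoning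

module _ {A : Set} (R : A → A → Set) (R-injective : ∀ {u u′ v} → R u v → R u′ v → u ≡ u′)
         (s : ℕ → A) (no-return : ∀ a → s (suc (suc a)) ≢ s a) where

  oriented : (∀ a → R (s a) (s (suc a)) ⊎ R (s (suc a)) (s a)) →
             R (s 0) (s 1) → ∀ a → R (s a) (s (suc a))
  oriented steps first zero    = first
  oriented steps first (suc a) with steps (suc a)
  ... | inj₁ forward  = forward
  ... | inj₂ backward = ⊥-elim (no-return a (R-injective backward (oriented steps first a)))

-- The cyclic group ℤₙ

module Cyclic (m : ℕ) where

  n : ℕ
  n = suc m

  [_] : ℕ → Fin n
  [ a ] = a mod n

  infixl 6 _⊕_ _⊖_
  infix 8 ⊖_

  _⊕_ : Fin n → Fin n → Fin n
  u ⊕ v = [ toℕ u + toℕ v ]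

  ⊖_ : Fin n → Fin n
  ⊖ u = [ n ∸ toℕ u ]

  _⊖_ : Fin n → Fin n → Fin n
  u ⊖ v = u ⊕ ⊖ v

  toℕ-[] : ∀ a → toℕ [ a ] ≡ a % n
  toℕ-[] a = toℕ-fromℕ< (m%n<n a n)

  toℕ-[]-< : ∀ {a} → a < n → toℕ [ a ] ≡ a
  toℕ-[]-< {a} a<n = trans (toℕ-[] a) (m<n⇒m%n≡m a<n)

  %≡⇒[]≡ : ∀ a b → a % n ≡ b % n → [ a ] ≡ [ b ]
  %≡⇒[]≡ a b eq = toℕ-injective (trans (toℕ-[] a) (trans eq (sym (toℕ-[] b))))

  [toℕ] : ∀ u → [ toℕ u ] ≡ u
  [toℕ] u = toℕ-injective (toℕ-[]-< (toℕ<n u))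

  toℕ≡⇒≡[] : ∀ {u t} → toℕ u ≡ t → u ≡ [ t ]
  toℕ≡⇒≡[] {u} eq = trans (sym ([toℕ] u)) (cong [_] eq)

  [+] : ∀ a b → [ a + b ] ≡ [ a ] ⊕ [ b ]
  [+] a b = %≡⇒[]≡ (a + b) (toℕ [ a ] + toℕ [ b ])
              (trans (%-distribˡ-+ a b n) (sym (cong₂ (λ x y → (x + y) % n) (toℕ-[] a) (toℕ-[] b))))

  [n] : [ n ] ≡ zero
  [n] = %≡⇒[]≡ n 0 (n%n≡0 n)

  ⊕-comm : ∀ u v → u ⊕ v ≡ v ⊕ u
  ⊕-comm u v = cong [_] (+-comm (toℕ u) (toℕ v))

  ⊕-assoc : ∀ u v w → (u ⊕ v) ⊕ w ≡ u ⊕ (v ⊕ w)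
  ⊕-assoc u v w = begin
    [ toℕ u + toℕ v ] ⊕ w          ≡⟨ cong ([ toℕ u + toℕ v ] ⊕_) ([toℕ] w) ⟨
    [ toℕ u + toℕ v ] ⊕ [ toℕ w ]  ≡⟨ [+] (toℕ u + toℕ v) (toℕ w) ⟨
    [ toℕ u + toℕ v + toℕ w ]      ≡⟨ cong [_] (+-assoc (toℕ u) (toℕ v) (toℕ w)) ⟩
    [ toℕ u + (toℕ v + toℕ w) ]    ≡⟨ [+] (toℕ u) (toℕ v + toℕ w) ⟩
    [ toℕ u ] ⊕ (v ⊕ w)            ≡⟨ cong (_⊕ (v ⊕ w)) ([toℕ] u) ⟩
    u ⊕ (v ⊕ w)                    ∎
    where open ≡-Reasoning

  ⊕-identityˡ : ∀ u → zero ⊕ u ≡ u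
  ⊕-identityˡ = [toℕ]

  ⊕-inverseˡ : ∀ u → ⊖ u ⊕ u ≡ zero
  ⊕-inverseˡ u = begin
    ⊖ u ⊕ u                    ≡⟨ cong (⊖ u ⊕_) ([toℕ] u) ⟨
    [ n ∸ toℕ u ] ⊕ [ toℕ u ]  ≡⟨ [+] (n ∸ toℕ u) (toℕ u) ⟨
    [ n ∸ toℕ u + toℕ u ]      ≡⟨ cong [_] (m∸n+n≡m (<⇒≤ (toℕ<n u))) ⟩
    [ n ]                      ≡⟨ [n] ⟩
    zero                       ∎
    where open ≡-Reasoning

  isAbelianGroup : IsAbelianGroup _≡_ _⊕_ zero (λ u → ⊖ u)
  isAbelianGroup = record
    { isGroup = record
      { isMonoid = record
        { isSemigroup = record
          { isMagma = record { isEquivalence = isEquivalence ; ∙-cong = cong₂ _⊕_ }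
          ; assoc = ⊕-assoc
          }
        ; identity = ⊕-identityˡ , λ u → trans (⊕-comm u zero) (⊕-identityˡ u)
        }
      ; inverse = ⊕-inverseˡ , λ u → trans (⊕-comm u (⊖ u)) (⊕-inverseˡ u)
      ; ⁻¹-cong = cong (λ u → ⊖ u)
      }
    ; comm = ⊕-comm
    }

  ℤₙ : AbelianGroup _ _
  ℤₙ = record { isAbelianGroup = isAbelianGroup }

  open AbelianGroupProperties ℤₙ
    using (//-rightDividesˡ; //-rightDividesʳ)
    renaming (ε⁻¹≈ε to ⊖-zero; ∙-cancelʳ to ⊕-cancelʳ; ⁻¹-anti-homo‿- to ⊖-⊖) public
  open IsAbelianGroup isAbelianGroup using () renaming (inverseʳ to ⊖-self) public

  ⊖⊕-cancel : ∀ u v → (u ⊖ v) ⊕ v ≡ u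
  ⊖⊕-cancel u v = //-rightDividesˡ v u

  ⊖-unique : ∀ {u v w} → w ⊕ v ≡ u → u ⊖ v ≡ w
  ⊖-unique {v = v} {w} refl = //-rightDividesʳ v w

  ⊕⊖-cancel : ∀ u v → (u ⊕ v) ⊖ u ≡ v
  ⊕⊖-cancel u v = ⊖-unique (⊕-comm v u)

  ⊖≡⇒ : ∀ {u v w} → u ⊖ v ≡ w → u ≡ v ⊕ w
  ⊖≡⇒ {u} {v} {w} eq = trans (sym (⊖⊕-cancel u v)) (trans (cong (_⊕ v) eq) (⊕-comm w v))

  ⊖-identityʳ : ∀ u → u ⊖ zero ≡ u
  ⊖-identityʳ u = trans (cong (u ⊕_) ⊖-zero) (trans (⊕-comm u zero) (⊕-identityˡ u))

  ⊖-translate : ∀ c u v → (u ⊕ c) ⊖ (v ⊕ c) ≡ u ⊖ v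
  ⊖-translate c u v = ⊖-unique (begin
    (u ⊖ v) ⊕ (v ⊕ c)  ≡⟨ ⊕-assoc (u ⊖ v) v c ⟨
    (u ⊖ v) ⊕ v ⊕ c    ≡⟨ cong (_⊕ c) (⊖⊕-cancel u v) ⟩
    u ⊕ c              ∎)
    where open ≡-Reasoning

  ⊖-reflect : ∀ c u v → (c ⊖ u) ⊖ (c ⊖ v) ≡ v ⊖ u
  ⊖-reflect c u v = ⊖-unique (begin
    (v ⊖ u) ⊕ (c ⊖ v)  ≡⟨ ⊕-comm (v ⊖ u) (c ⊖ v) ⟩
    (c ⊖ v) ⊕ (v ⊖ u)  ≡⟨ ⊕-assoc (c ⊖ v) v (⊖ u) ⟨
    (c ⊖ v) ⊕ v ⊖ u    ≡⟨ cong (_⊖ u) (⊖⊕-cancel c v) ⟩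
    c ⊖ u              ∎)
    where open ≡-Reasoning

  shift-injective : ∀ a {t t′} → t < n → t′ < n → [ a + t ] ≡ [ a + t′ ] → t ≡ t′
  shift-injective a {t} {t′} t<n t′<n eq = begin
    t                             ≡⟨ toℕ-[]-< t<n ⟨
    toℕ [ t ]                     ≡⟨ cong toℕ (⊕⊖-cancel [ a ] [ t ]) ⟨
    toℕ ([ a ] ⊕ [ t ] ⊖ [ a ])   ≡⟨ cong (λ x → toℕ (x ⊖ [ a ])) (trans (sym ([+] a t)) (trans eq ([+] a t′))) ⟩
    toℕ ([ a ] ⊕ [ t′ ] ⊖ [ a ])  ≡⟨ cong toℕ (⊕⊖-cancel [ a ] [ t′ ]) ⟩
    toℕ [ t′ ]                    ≡⟨ toℕ-[]-< t′<n ⟩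
    t′                            ∎
    where open ≡-Reasoning

  one : Fin n
  one = [ 1 ]

  Succ : Fin n → Fin n → Set
  Succ u v = v ≡ u ⊕ one

  [suc] : ∀ a → Succ [ a ] [ suc a ]
  [suc] a = trans (cong [_] (+-comm 1 a)) ([+] a 1)

  ascending : ∀ (s : ℕ → Fin n) → (∀ a → Succ (s a) (s (suc a))) → ∀ a → s a ≡ s 0 ⊕ [ a ]
  ascending s step zero    = sym (trans (⊕-comm (s 0) zero) (⊕-identityˡ (s 0)))
  ascending s step (suc a) = begin
    s (suc a)            ≡⟨ step a ⟩
    s a ⊕ one            ≡⟨ cong (_⊕ one) (ascending s step a) ⟩
    s 0 ⊕ [ a ] ⊕ one    ≡⟨ ⊕-assoc (s 0) [ a ] one ⟩
    s 0 ⊕ ([ a ] ⊕ one)  ≡⟨ cong (s 0 ⊕_) ([suc] a) ⟨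
    s 0 ⊕ [ suc a ]      ∎
    where open ≡-Reasoning

  descending : ∀ (s : ℕ → Fin n) → (∀ a → Succ (s (suc a)) (s a)) → ∀ a → s a ≡ s 0 ⊖ [ a ]
  descending s step a = sym (⊖-unique (sym (telescope a)))
    where
    telescope : ∀ a → s 0 ≡ s a ⊕ [ a ]
    telescope zero    = sym (trans (⊕-comm (s 0) zero) (⊕-identityˡ (s 0)))
    telescope (suc a) = begin
      s 0                        ≡⟨ telescope a ⟩
      s a ⊕ [ a ]                ≡⟨ cong (_⊕ [ a ]) (step a) ⟩
      s (suc a) ⊕ one ⊕ [ a ]    ≡⟨ ⊕-assoc (s (suc a)) one [ a ] ⟩
      s (suc a) ⊕ (one ⊕ [ a ])  ≡⟨ cong (s (suc a) ⊕_) ([+] 1 a) ⟨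
      s (suc a) ⊕ [ suc a ]      ∎
      where open ≡-Reasoning

  affine-pair : ∀ (f : Fin n → Fin n) {x y} →
                (∀ z → f z ≡ f zero ⊕ z) ⊎ (∀ z → f z ≡ f zero ⊖ z) →
                (f zero ≡ zero × f x ≡ y) ⊎ (f zero ≡ y × f x ≡ zero) →
                x ≡ y ⊎ y ⊕ x ≡ zero
  affine-pair f {x} {y} (inj₁ plus) (inj₁ (f0≡0 , fx≡y)) = inj₁ (begin
    x             ≡⟨ ⊕-identityˡ x ⟨
    zero ⊕ x      ≡⟨ cong (_⊕ x) f0≡0 ⟨
    f zero ⊕ x    ≡⟨ plus x ⟨
    f x           ≡⟨ fx≡y ⟩
    y             ∎)
    where open ≡-Reasoning
  affine-pair f {x} {y} (inj₁ plus) (inj₂ (f0≡y , fx≡0)) =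
    inj₂ (trans (cong (_⊕ x) (sym f0≡y)) (trans (sym (plus x)) fx≡0))
  affine-pair f {x} {y} (inj₂ minus) (inj₁ (f0≡0 , fx≡y)) = inj₂ (begin
    y ⊕ x               ≡⟨ cong (_⊕ x) fx≡y ⟨
    f x ⊕ x             ≡⟨ cong (_⊕ x) (trans (minus x) (cong (_⊖ x) f0≡0)) ⟩
    (zero ⊖ x) ⊕ x      ≡⟨ ⊖⊕-cancel zero x ⟩
    zero                ∎)
    where open ≡-Reasoning
  affine-pair f {x} {y} (inj₂ minus) (inj₂ (f0≡y , fx≡0)) = inj₁ (sym (begin
    y           ≡⟨ ⊖≡⇒ {y} {x} {zero} (trans (cong (_⊖ x) (sym f0≡y)) (trans (sym (minus x)) fx≡0)) ⟩
    x ⊕ zero    ≡⟨ ⊕-comm x zero ⟩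
    zero ⊕ x    ≡⟨ ⊕-identityˡ x ⟩
    x           ∎))
    where open ≡-Reasoning

  translation : Fin n → Permutation′ n
  translation c = permutation (_⊕ c) (λ u → u ⊖ c) (λ u → ⊖⊕-cancel u c) (λ u → ⊖-unique refl)

  reflection : Fin n → Permutation′ n
  reflection c = permutation (λ u → c ⊖ u) (λ u → c ⊖ u) involutive involutive
    where
    involutive : ∀ u → c ⊖ (c ⊖ u) ≡ u
    involutive u = ⊖-unique (trans (⊕-comm u (c ⊖ u)) (⊖⊕-cancel c u))

-- Circulant graphs

module Circulant (m : ℕ) (S : ℕ → Bool) where

  open Cyclic m

  G : Graph n
  G = Circ n S

  diffMod≡toℕ-⊖ : ∀ u v → diffMod u v ≡ toℕ (u ⊖ v)
  diffMod≡toℕ-⊖ u v = begin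
    (toℕ u + (n ∸ toℕ v)) % n    ≡⟨ toℕ-[] (toℕ u + (n ∸ toℕ v)) ⟨
    toℕ [ toℕ u + (n ∸ toℕ v) ]  ≡⟨ cong toℕ ([+] (toℕ u) (n ∸ toℕ v)) ⟩
    toℕ ([ toℕ u ] ⊕ ⊖ v)        ≡⟨ cong (λ w → toℕ (w ⊖ v)) ([toℕ] u) ⟩
    toℕ (u ⊖ v)                  ∎
    where open ≡-Reasoning

  Circ-⊖ : ∀ u v → G u v ≡ S (toℕ (u ⊖ v)) ∨ S (toℕ (v ⊖ u))
  Circ-⊖ u v = cong₂ (λ a b → S a ∨ S b) (diffMod≡toℕ-⊖ u v) (diffMod≡toℕ-⊖ v u)

  Circ-sym : ∀ u v → G u v ≡ G v u
  Circ-sym u v = ∨-comm (S (diffMod u v)) (S (diffMod v u))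

  Circ-irreflexive : S 0 ≡ false → ∀ u → G u u ≡ false
  Circ-irreflexive S0≡false u = begin
    G u u                              ≡⟨ Circ-⊖ u u ⟩
    S (toℕ (u ⊖ u)) ∨ S (toℕ (u ⊖ u))  ≡⟨ cong (λ x → S (toℕ x) ∨ S (toℕ x)) (⊖-self u) ⟩
    S 0 ∨ S 0                          ≡⟨ cong (λ b → b ∨ b) S0≡false ⟩
    false                              ∎
    where open ≡-Reasoning

  translation-isAut : ∀ c → IsAut G (translation c)
  translation-isAut c u v = begin
    G (u ⊕ c) (v ⊕ c)
      ≡⟨ Circ-⊖ (u ⊕ c) (v ⊕ c) ⟩
    S (toℕ ((u ⊕ c) ⊖ (v ⊕ c))) ∨ S (toℕ ((v ⊕ c) ⊖ (u ⊕ c)))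
      ≡⟨ cong₂ (λ x y → S (toℕ x) ∨ S (toℕ y)) (⊖-translate c u v) (⊖-translate c v u) ⟩
    S (toℕ (u ⊖ v)) ∨ S (toℕ (v ⊖ u))
      ≡⟨ Circ-⊖ u v ⟨
    G u v
      ∎
    where open ≡-Reasoning

  reflection-isAut : ∀ c → IsAut G (reflection c)
  reflection-isAut c u v = begin
    G (c ⊖ u) (c ⊖ v)
      ≡⟨ Circ-⊖ (c ⊖ u) (c ⊖ v) ⟩
    S (toℕ ((c ⊖ u) ⊖ (c ⊖ v))) ∨ S (toℕ ((c ⊖ v) ⊖ (c ⊖ u)))
      ≡⟨ cong₂ (λ x y → S (toℕ x) ∨ S (toℕ y)) (⊖-reflect c u v) (⊖-reflect c v u) ⟩
    S (toℕ (v ⊖ u)) ∨ S (toℕ (u ⊖ v))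
      ≡⟨ Circ-⊖ v u ⟨
    G v u
      ≡⟨ Circ-sym v u ⟩
    G u v
      ∎
    where open ≡-Reasoning

  isCayley : S 0 ≡ false → IsCayley G
  isCayley S0≡false =
    _⊕_ , zero , (λ u → ⊖ u) , IsAbelianGroup.isGroup isAbelianGroup ,
    G zero , symmetric , Circ-irreflexive S0≡false zero , λ g h → sym (translate-to-origin g h)
    where
    open ≡-Reasoning
    translate-to-origin : ∀ g h → G zero (⊖ g ⊕ h) ≡ G g h
    translate-to-origin g h = begin
      G zero (⊖ g ⊕ h)   ≡⟨ cong₂ G (⊖-self g) (⊕-comm h (⊖ g)) ⟨
      G (g ⊖ g) (h ⊖ g)  ≡⟨ translation-isAut (⊖ g) g h ⟩
      G g h              ∎
    symmetric : ∀ g → G zero (⊖ g) ≡ G zero g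
    symmetric g = begin
      G zero (⊖ g)                ≡⟨ cong₂ G (⊖-self zero) (⊕-identityˡ (⊖ g)) ⟨
      G (zero ⊖ zero) (zero ⊖ g)  ≡⟨ reflection-isAut zero zero g ⟩
      G zero g                    ∎

  arc-cases : ∀ {u v} → G u v ≡ true → S (toℕ (v ⊖ u)) ≡ true ⊎ S (toℕ (u ⊖ v)) ≡ true
  arc-cases {u} {v} uv = swap (∨≡true (S (toℕ (u ⊖ v))) (S (toℕ (v ⊖ u))) (trans (sym (Circ-⊖ u v)) uv))

  arc-to-origin : ∀ {u v} → G u v ≡ true →
                  Σ (Fin n) λ x → S (toℕ x) ≡ true × ArcRel G (u , v) (zero , x)
  arc-to-origin {u} {v} uv with arc-cases {u} {v} uv
  ... | inj₁ e = v ⊖ u , e , translation (⊖ u) , translation-isAut (⊖ u) , ⊖-self u , refl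
  ... | inj₂ e = u ⊖ v , e , reflection u , reflection-isAut u , ⊖-self u , refl

module Band (k g : ℕ) where

  open Cyclic (k + (g + k)) public
  open Circulant (k + (g + k)) (upToSet k) public

  band : ℕ → Bool
  band t = upToSet k ((n ∸ t) % n) ∨ upToSet k t

  -- With n = 1 + k + g + k, the offsets 1, …, k and n − k, …, n − 1 are adjacent; the g in between are not.
  data Position : ℕ → Set where
    origin : Position 0
    low    : ∀ {i} → i < k → Position (suc i)
    gap    : ∀ {i} → i < g → Position (suc (k + i))
    high   : ∀ {i} → i < k → Position (suc (k + (g + i)))

  position : ∀ {t} → t < n → Position t
  position {zero}  _ = origin
  position {suc t} (s≤s t<m) with split k t<m
  ... | left i<k = low i<k
  ... | right i<g+k with split g i<g+k
  ...   | left j<g  = gap j<g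
  ...   | right j<k = high j<k

  band-origin : band 0 ≡ false
  band-origin = cong (λ d → upToSet k d ∨ false) (n%n≡0 n)

  band-suc : ∀ t → band (suc t) ≡ upToSet k ((k + (g + k)) ∸ t) ∨ (t <ᵇ k)
  band-suc t = cong (λ d → upToSet k d ∨ (t <ᵇ k)) (m<n⇒m%n≡m (s≤s (m∸n≤m (k + (g + k)) t)))

  band-low : ∀ {i} → i < k → band (suc i) ≡ true
  band-low {i} i<k = trans (band-suc i) (trans (cong (x ∨_) (<ᵇ-true i<k)) (∨-zeroʳ x))
    where
    x : Bool
    x = upToSet k ((k + (g + k)) ∸ i)

  band-gap : ∀ {i} → i < g → band (suc (k + i)) ≡ false
  band-gap {i} i<g = trans (band-suc (k + i)) (cong₂ _∨_ far (<ᵇ-false (m≤m+n k i)))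
    where
    open ≡-Reasoning
    far : upToSet k ((k + (g + k)) ∸ (k + i)) ≡ false
    far = begin
      upToSet k ((k + (g + k)) ∸ (k + i))  ≡⟨ cong (upToSet k) ([m+n]∸[m+o]≡n∸o k (g + k) i) ⟩
      upToSet k ((g + k) ∸ i)              ≡⟨ cong (upToSet k) (+-∸-comm k (<⇒≤ i<g)) ⟩
      upToSet k ((g ∸ i) + k)              ≡⟨ upToSet-false (+-monoˡ-< k (m<n⇒0<n∸m i<g)) ⟩
      false                                ∎

  band-high : ∀ {i} → i < k → band (suc (k + (g + i))) ≡ true
  band-high {i} i<k = trans (band-suc (k + (g + i))) (cong (_∨ (k + (g + i) <ᵇ k)) near)
    where
    open ≡-Reasoning
    near : upToSet k ((k + (g + k)) ∸ (k + (g + i))) ≡ true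
    near = begin
      upToSet k ((k + (g + k)) ∸ (k + (g + i)))  ≡⟨ cong (upToSet k) ([m+n]∸[m+o]≡n∸o k (g + k) (g + i)) ⟩
      upToSet k ((g + k) ∸ (g + i))              ≡⟨ cong (upToSet k) ([m+n]∸[m+o]≡n∸o g k i) ⟩
      upToSet k (k ∸ i)                          ≡⟨ upToSet-true (m<n⇒0<n∸m i<k) (m∸n≤m k i) ⟩
      true                                       ∎

  Circ-band : ∀ u v → G u v ≡ band (toℕ (v ⊖ u))
  Circ-band u v = begin
    G u v
      ≡⟨ Circ-⊖ u v ⟩
    upToSet k (toℕ (u ⊖ v)) ∨ upToSet k (toℕ (v ⊖ u))
      ≡⟨ cong (λ x → upToSet k (toℕ x) ∨ upToSet k (toℕ (v ⊖ u))) (⊖-⊖ v u) ⟨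
    upToSet k (toℕ (⊖ (v ⊖ u))) ∨ upToSet k (toℕ (v ⊖ u))
      ≡⟨ cong (λ d → upToSet k d ∨ upToSet k (toℕ (v ⊖ u))) (toℕ-[] (n ∸ toℕ (v ⊖ u))) ⟩
    band (toℕ (v ⊖ u))
      ∎
    where open ≡-Reasoning

  Circ-shift : ∀ a {t} → t < n → G [ a ] [ a + t ] ≡ band t
  Circ-shift a {t} t<n = begin
    G [ a ] [ a + t ]                   ≡⟨ Circ-band [ a ] [ a + t ] ⟩
    band (toℕ ([ a + t ] ⊖ [ a ]))      ≡⟨ cong (λ x → band (toℕ (x ⊖ [ a ]))) ([+] a t) ⟩
    band (toℕ ([ a ] ⊕ [ t ] ⊖ [ a ]))  ≡⟨ cong (λ x → band (toℕ x)) (⊕⊖-cancel [ a ] [ t ]) ⟩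
    band (toℕ [ t ])                    ≡⟨ cong band (toℕ-[]-< t<n) ⟩
    band t                              ∎
    where open ≡-Reasoning

  Circ-origin : ∀ w → G zero w ≡ band (toℕ w)
  Circ-origin w = trans (cong (G zero) (sym ([toℕ] w))) (Circ-shift 0 (toℕ<n w))

-- Orbits of Circ(n, {1, …, k})

module BandOrbits (k r : ℕ) where

  open Band k (2 + r)
  open PrivateNeighbours G

  low<n : ∀ {i} → i < k → suc i < n
  low<n i<k = s≤s (≤-trans i<k (m≤m+n k _))

  gap<n : ∀ {i} → i < 2 + r → suc (k + i) < n
  gap<n i<g = s≤s (+-monoʳ-< k (≤-trans i<g (m≤m+n (2 + r) k)))

  high<n : ∀ {i} → i < k → suc (k + (2 + r + i)) < n
  high<n i<k = s≤s (+-monoʳ-< k (+-monoʳ-< (2 + r) i<k))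

  2<n : 2 < n
  2<n = s≤s (≤-trans (s≤s (s≤s z≤n)) (m≤n+m (2 + r + k) k))

  NeighbourOffset : ℕ → Set
  NeighbourOffset t = Σ ℕ λ i → i < k × (t ≡ suc i ⊎ t ≡ suc (k + (2 + r + i)))

  neighbour-position : ∀ {t} → Position t → band t ≡ true → NeighbourOffset t
  neighbour-position origin     b = ⊥-elim (true≢false (trans (sym b) band-origin))
  neighbour-position (low i<k)  _ = _ , i<k , inj₁ refl
  neighbour-position (gap i<g)  b = ⊥-elim (true≢false (trans (sym b) (band-gap i<g)))
  neighbour-position (high i<k) _ = _ , i<k , inj₂ refl

  origin-neighbour : ∀ {w} → G zero w ≡ true → NeighbourOffset (toℕ w)
  origin-neighbour {w} 0w = neighbour-position (position (toℕ<n w)) (trans (sym (Circ-origin w)) 0w)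

  -- The only private neighbour of 0 with respect to 1 is −k.
  privateNeighbour-one : ∀ {w} → PrivateNeighbour zero one w → w ≡ [ suc (k + (2 + r)) ]
  privateNeighbour-one {w} (0w , w≢1 , 1w) = from-offset (origin-neighbour 0w)
    where
    open ≡-Reasoning
    from-offset : NeighbourOffset (toℕ w) → w ≡ [ suc (k + (2 + r)) ]
    from-offset (zero  , _   , inj₁ w≡1) = ⊥-elim (w≢1 (toℕ≡⇒≡[] w≡1))
    from-offset (suc i , i<k , inj₁ w≡)  = ⊥-elim (true≢false (begin
      true                   ≡⟨ band-low (≤-trans (n≤1+n _) i<k) ⟨
      band (suc i)           ≡⟨ Circ-shift 1 (low<n (≤-trans (n≤1+n _) i<k)) ⟨
      G one [ suc (suc i) ]  ≡⟨ cong (G one) (toℕ≡⇒≡[] w≡) ⟨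
      G one w                ≡⟨ 1w ⟩
      false                  ∎))
    from-offset (zero  , _   , inj₂ w≡)  =
      toℕ≡⇒≡[] (trans w≡ (cong (λ x → suc (k + x)) (+-identityʳ (2 + r))))
    from-offset (suc i , i<k , inj₂ w≡)  = ⊥-elim (true≢false (begin
      true                                 ≡⟨ band-high (≤-trans (n≤1+n _) i<k) ⟨
      band (suc (k + (2 + r + i)))         ≡⟨ cong band shift ⟨
      band (k + (2 + r + suc i))           ≡⟨ Circ-shift 1 (≤-trans (n≤1+n _) (high<n i<k)) ⟨
      G one [ suc (k + (2 + r + suc i)) ]  ≡⟨ cong (G one) (toℕ≡⇒≡[] w≡) ⟨
      G one w                              ≡⟨ 1w ⟩
      false                                ∎))
      where
      shift : k + (2 + r + suc i) ≡ suc (k + (2 + r + i))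
      shift = trans (cong (k +_) (+-suc (2 + r) i)) (+-suc k (2 + r + i))

  atMostOnePrivate-one : AtMostOnePrivate zero one
  atMostOnePrivate-one pw pw′ = trans (privateNeighbour-one pw) (sym (privateNeighbour-one pw′))

  -- For d ≥ 2 both d − (k + 1) and d − (k + 2) are private neighbours of 0 with respect to d.
  ¬atMostOnePrivate-[2+e] : ∀ {e} → suc e < k → ¬ AtMostOnePrivate zero [ suc (suc e) ]
  ¬atMostOnePrivate-[2+e] {e} e<k unique =
    1+n≢n (+-cancelˡ-≡ k (suc r) r (suc-injective
      (shift-injective d (gap<n ≤-refl) (gap<n (n≤1+n _)) (unique far near))))
    where
    open ℕ-Solver.+-*-Solver using (solve; _:+_; _:=_; con)
    d : ℕ
    d = suc (suc e)
    private-neighbour : ∀ {i j} → i < 2 + r → j < k → d + suc (k + i) ≡ suc (k + (2 + r + j)) →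
                        PrivateNeighbour zero [ d ] [ d + suc (k + i) ]
    private-neighbour {i} {j} i<g j<k eq =
      trans (Circ-origin [ d + suc (k + i) ])
            (trans (cong band (trans (toℕ-[]-< (subst (_< n) (sym eq) (high<n j<k))) eq)) (band-high j<k)) ,
      (λ w≡d → 0≢1+n (sym (shift-injective d (gap<n i<g) z<s (trans w≡d (cong [_] (sym (+-identityʳ d))))))) ,
      trans (Circ-shift d (gap<n i<g)) (band-gap i<g)
    far : PrivateNeighbour zero [ d ] [ d + suc (k + suc r) ]
    far = private-neighbour ≤-refl e<k
      (solve 3 (λ e k r → con 2 :+ e :+ (con 1 :+ (k :+ (con 1 :+ r)))
                          := con 1 :+ (k :+ (con 2 :+ r :+ (con 1 :+ e)))) refl e k r)
    near : PrivateNeighbour zero [ d ] [ d + suc (k + r) ]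
    near = private-neighbour (n≤1+n _) (≤-trans (n≤1+n _) e<k)
      (solve 3 (λ e k r → con 2 :+ e :+ (con 1 :+ (k :+ r))
                          := con 1 :+ (k :+ (con 2 :+ r :+ e))) refl e k r)

  atMostOnePrivate⇒one : ∀ {x} → upToSet k (toℕ x) ≡ true → AtMostOnePrivate zero x → x ≡ one
  atMostOnePrivate⇒one {x} x∈S unique = from-index (upToSet-inv (toℕ x) x∈S)
    where
    from-index : Σ ℕ (λ i → i < k × toℕ x ≡ suc i) → x ≡ one
    from-index (zero  , _   , x≡1) = toℕ≡⇒≡[] x≡1
    from-index (suc e , e<k , x≡)  =
      ⊥-elim (¬atMostOnePrivate-[2+e] e<k (subst (AtMostOnePrivate zero) (toℕ≡⇒≡[] x≡) unique))

  CycleEdge : Fin n → Fin n → Set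
  CycleEdge u v = Succ u v ⊎ Succ v u

  cycleEdge⇒atMostOnePrivate : ∀ {u v} → CycleEdge u v → AtMostOnePrivate u v
  cycleEdge⇒atMostOnePrivate {u} (inj₁ refl) =
    subst₂ AtMostOnePrivate (⊕-identityˡ u) (⊕-comm one u)
      (isAut-AtMostOnePrivate (translation u) (translation-isAut u) {zero} {one} atMostOnePrivate-one)
  cycleEdge⇒atMostOnePrivate {u} (inj₂ refl) =
    subst₂ AtMostOnePrivate (⊖-identityʳ u) (⊖-unique refl)
      (isAut-AtMostOnePrivate (reflection u) (reflection-isAut u) {zero} {one} atMostOnePrivate-one)

  atMostOnePrivate⇒cycleEdge : ∀ {u v} → G u v ≡ true → AtMostOnePrivate u v → CycleEdge u v
  atMostOnePrivate⇒cycleEdge {u} {v} uv unique with arc-cases {u} {v} uv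
  ... | inj₁ v-u∈S = inj₁ (⊖≡⇒ {v} {u} (atMostOnePrivate⇒one {v ⊖ u} v-u∈S
    (subst (λ x → AtMostOnePrivate x (v ⊖ u)) (⊖-self u)
      (isAut-AtMostOnePrivate (translation (⊖ u)) (translation-isAut (⊖ u)) {u} {v} unique))))
  ... | inj₂ u-v∈S = inj₂ (⊖≡⇒ {u} {v} (atMostOnePrivate⇒one {u ⊖ v} u-v∈S
    (subst (λ x → AtMostOnePrivate x (u ⊖ v)) (⊖-self u)
      (isAut-AtMostOnePrivate (reflection u) (reflection-isAut u) {u} {v} unique))))

  module _ (0<k : 0 < k) where

    cycleEdge⇒adjacent : ∀ {u v} → CycleEdge u v → G u v ≡ true
    cycleEdge⇒adjacent {u} (inj₁ refl) = begin
      G u (u ⊕ one)               ≡⟨ Circ-band u (u ⊕ one) ⟩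
      band (toℕ ((u ⊕ one) ⊖ u))  ≡⟨ cong (λ x → band (toℕ x)) (⊕⊖-cancel u one) ⟩
      band (toℕ one)              ≡⟨ cong band (toℕ-[]-< (low<n 0<k)) ⟩
      band 1                      ≡⟨ band-low 0<k ⟩
      true                        ∎
      where open ≡-Reasoning
    cycleEdge⇒adjacent {v = v} (inj₂ refl) =
      trans (Circ-sym (v ⊕ one) v) (cycleEdge⇒adjacent {v} (inj₁ refl))

    isAut-cycleEdge : ∀ {σ} → IsAut G σ → ∀ {u v} → CycleEdge u v → CycleEdge (σ ⟨$⟩ʳ u) (σ ⟨$⟩ʳ v)
    isAut-cycleEdge {σ} σ-aut {u} {v} uv =
      atMostOnePrivate⇒cycleEdge {σ ⟨$⟩ʳ u} {σ ⟨$⟩ʳ v} (trans (σ-aut u v) (cycleEdge⇒adjacent uv))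
        (isAut-AtMostOnePrivate σ σ-aut {u} {v} (cycleEdge⇒atMostOnePrivate uv))

    isAut-affine : ∀ {σ} → IsAut G σ →
                   (∀ x → σ ⟨$⟩ʳ x ≡ (σ ⟨$⟩ʳ zero) ⊕ x) ⊎ (∀ x → σ ⟨$⟩ʳ x ≡ (σ ⟨$⟩ʳ zero) ⊖ x)
    isAut-affine {σ} σ-aut = from-first-step (steps 0)
      where
      open ≡-Reasoning

      s : ℕ → Fin n
      s a = σ ⟨$⟩ʳ [ a ]

      steps : ∀ a → CycleEdge (s a) (s (suc a))
      steps a = isAut-cycleEdge {σ} σ-aut (inj₁ ([suc] a))

      no-return : ∀ a → s (suc (suc a)) ≢ s a
      no-return a eq = 1+n≢0 (shift-injective a 2<n z<s (begin
        [ a + 2 ]        ≡⟨ cong [_] (+-comm a 2) ⟩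
        [ suc (suc a) ]  ≡⟨ permutation-injective σ eq ⟩
        [ a ]            ≡⟨ cong [_] (+-identityʳ a) ⟨
        [ a + 0 ]        ∎))

      on-vertices : ∀ {f : Fin n → Fin n} → (∀ a → s a ≡ f [ a ]) → ∀ x → σ ⟨$⟩ʳ x ≡ f x
      on-vertices {f} s≡f x = begin
        σ ⟨$⟩ʳ x     ≡⟨ cong (σ ⟨$⟩ʳ_) ([toℕ] x) ⟨
        s (toℕ x)    ≡⟨ s≡f (toℕ x) ⟩
        f [ toℕ x ]  ≡⟨ cong f ([toℕ] x) ⟩
        f x          ∎

      from-first-step : CycleEdge (s 0) (s 1) →
                        (∀ x → σ ⟨$⟩ʳ x ≡ (σ ⟨$⟩ʳ zero) ⊕ x) ⊎ (∀ x → σ ⟨$⟩ʳ x ≡ (σ ⟨$⟩ʳ zero) ⊖ x)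
      from-first-step (inj₁ forward) = inj₁ (on-vertices {(σ ⟨$⟩ʳ zero) ⊕_} (ascending s
        (oriented Succ (λ eq eq′ → ⊕-cancelʳ one _ _ (trans (sym eq) eq′)) s no-return steps forward)))
      from-first-step (inj₂ backward) = inj₂ (on-vertices {λ x → (σ ⟨$⟩ʳ zero) ⊖ x} (descending s
        (oriented (flip Succ) (λ eq eq′ → trans eq (sym eq′)) s no-return (swap ∘ steps) backward)))

  rep : Fin k → Fin n × Fin n
  rep i = zero , [ suc (toℕ i) ]

  rep-isArc : ∀ i → IsArc G (rep i)
  rep-isArc i = begin
    G zero [ suc (toℕ i) ]      ≡⟨ Circ-origin [ suc (toℕ i) ] ⟩
    band (toℕ [ suc (toℕ i) ])  ≡⟨ cong band (toℕ-[]-< (low<n (toℕ<n i))) ⟩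
    band (suc (toℕ i))          ≡⟨ band-low (toℕ<n i) ⟩
    true                        ∎
    where open ≡-Reasoning

  rep-index : ∀ {x} → upToSet k (toℕ x) ≡ true → Σ (Fin k) λ i → x ≡ [ suc (toℕ i) ]
  rep-index {x} x∈S with upToSet-inv (toℕ x) x∈S
  ... | i , i<k , x≡ = fromℕ< i<k , toℕ≡⇒≡[] (trans x≡ (cong suc (sym (toℕ-fromℕ< i<k))))

  rep-covers : ∀ {u v} → G u v ≡ true → Σ (Fin k) λ i → ArcRel G (u , v) (rep i)
  rep-covers {u} {v} uv with arc-to-origin {u} {v} uv
  ... | x , x∈S , rel with rep-index {x} x∈S
  ...   | i , x≡ = i , subst (λ y → ArcRel G (u , v) (zero , y)) x≡ rel

  rep-distinct : ∀ i j → EdgeRel G (rep i) (rep j) → i ≡ j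
  rep-distinct i j (σ , σ-aut , maps)
    with affine-pair (σ ⟨$⟩ʳ_) (isAut-affine (≤-trans (s≤s z≤n) (toℕ<n i)) {σ} σ-aut) maps
  ... | inj₁ same = toℕ-injective (suc-injective (begin
    suc (toℕ i)          ≡⟨ toℕ-[]-< (low<n (toℕ<n i)) ⟨
    toℕ [ suc (toℕ i) ]  ≡⟨ cong toℕ same ⟩
    toℕ [ suc (toℕ j) ]  ≡⟨ toℕ-[]-< (low<n (toℕ<n j)) ⟩
    suc (toℕ j)          ∎))
    where open ≡-Reasoning
  ... | inj₂ opposite = ⊥-elim (1+n≢0 (begin
    suc (toℕ j) + suc (toℕ i)                ≡⟨ toℕ-[]-< bound ⟨
    toℕ [ suc (toℕ j) + suc (toℕ i) ]        ≡⟨ cong toℕ ([+] (suc (toℕ j)) (suc (toℕ i))) ⟩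
    toℕ ([ suc (toℕ j) ] ⊕ [ suc (toℕ i) ])  ≡⟨ cong toℕ opposite ⟩
    0                                        ∎))
    where
    open ≡-Reasoning
    bound : suc (toℕ j) + suc (toℕ i) < n
    bound = s≤s (≤-trans (+-mono-≤ (toℕ<n j) (toℕ<n i)) (+-monoʳ-≤ k (m≤n+m k (2 + r))))

  arcOrbits : ArcOrbits G k
  arcOrbits = rep , rep-isArc , (λ i j rel → rep-distinct i j (ArcRel⇒EdgeRel rel)) ,
              λ (u , v) uv → rep-covers {u} {v} uv

  edgeOrbits : EdgeOrbits G k
  edgeOrbits = rep , rep-isArc , rep-distinct ,
               λ (u , v) uv → map₂ ArcRel⇒EdgeRel (rep-covers {u} {v} uv)

-- The kernel of Circ(n, {1, …, k})

sumℚ≡sum : ∀ {n} (f : Fin n → ℚ) → sumℚ f ≡ sum f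
sumℚ≡sum {zero}  f = refl
sumℚ≡sum {suc n} f = cong (f zero ℚ.+_) (sumℚ≡sum (f ∘ suc))

module BandKernel (k g : ℕ) where

  open Band k g
  open ℕ-Solver.+-*-Solver using (solve; _:+_; _:=_; con)

  weight : ℕ → ℚ
  weight t = if band t then 1ℚ else 0ℚ

  weight-true : ∀ t → band t ≡ true → ∀ x → weight t ℚ.* x ≡ x
  weight-true t eq x = trans (cong (λ b → (if b then 1ℚ else 0ℚ) ℚ.* x) eq) (ℚ.*-identityˡ x)

  weight-false : ∀ t → band t ≡ false → ∀ x → weight t ℚ.* x ≡ 0ℚ
  weight-false t eq x = trans (cong (λ b → (if b then 1ℚ else 0ℚ) ℚ.* x) eq) (ℚ.*-zeroˡ x)

  weighted-band-sum : ∀ (f : ℕ → ℚ) →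
                      ∑< n (λ t → weight t ℚ.* f t) ≡
                      ∑< k (λ i → f (suc i)) ℚ.+ ∑< k (λ i → f (suc (k + (g + i))))
  weighted-band-sum f = begin
    w 0 ℚ.+ ∑< (k + (g + k)) lower
      ≡⟨ cong₂ ℚ._+_ (weight-false 0 band-origin (f 0)) (∑<-+ k (g + k) lower) ⟩
    0ℚ ℚ.+ (∑< k lower ℚ.+ ∑< (g + k) rest)
      ≡⟨ ℚ.+-identityˡ (∑< k lower ℚ.+ ∑< (g + k) rest) ⟩
    ∑< k lower ℚ.+ ∑< (g + k) rest
      ≡⟨ cong (∑< k lower ℚ.+_) (∑<-+ g k rest) ⟩
    ∑< k lower ℚ.+ (∑< g rest ℚ.+ ∑< k upper)
      ≡⟨ cong (λ z → ∑< k lower ℚ.+ (z ℚ.+ ∑< k upper)) (∑<-zero g gap-vanishes) ⟩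
    ∑< k lower ℚ.+ (0ℚ ℚ.+ ∑< k upper)
      ≡⟨ cong (∑< k lower ℚ.+_) (ℚ.+-identityˡ (∑< k upper)) ⟩
    ∑< k lower ℚ.+ ∑< k upper
      ≡⟨ cong₂ ℚ._+_ (∑<-cong k low-survives) (∑<-cong k high-survives) ⟩
    ∑< k (λ i → f (suc i)) ℚ.+ ∑< k (λ i → f (suc (k + (g + i))))
      ∎
    where
    open ≡-Reasoning
    w : ℕ → ℚ
    w t = weight t ℚ.* f t
    lower rest upper : ℕ → ℚ
    lower i = w (suc i)
    rest t  = w (suc (k + t))
    upper i = w (suc (k + (g + i)))
    low-survives : ∀ {i} → i < k → lower i ≡ f (suc i)
    low-survives {i} i<k = weight-true (suc i) (band-low i<k) (f (suc i))
    high-survives : ∀ {i} → i < k → upper i ≡ f (suc (k + (g + i)))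
    high-survives {i} i<k = weight-true (suc (k + (g + i))) (band-high i<k) (f (suc (k + (g + i))))
    gap-vanishes : ∀ {i} → i < g → rest i ≡ 0ℚ
    gap-vanishes {i} i<g = weight-false (suc (k + i)) (band-gap i<g) (f (suc (k + i)))

  row-sum : ∀ (y : Fin n → ℚ) a →
            sumℚ (λ v → A[ G ] [ a ] v ℚ.* y v) ≡ ∑< n (λ t → weight t ℚ.* y [ a + t ])
  row-sum y a = begin
    sumℚ (λ v → A[ G ] [ a ] v ℚ.* y v)
      ≡⟨ sumℚ≡sum (λ v → A[ G ] [ a ] v ℚ.* y v) ⟩
    sum (λ v → A[ G ] [ a ] v ℚ.* y v)
      ≡⟨ sum-permute (λ v → A[ G ] [ a ] v ℚ.* y v) (translation [ a ]) ⟩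
    sum (λ v → A[ G ] [ a ] (v ⊕ [ a ]) ℚ.* y (v ⊕ [ a ]))
      ≡⟨ sum-cong-≗ (λ v → cong₂ ℚ._*_ (entry v) (cong y (vertex v))) ⟩
    ∑< n (λ t → weight t ℚ.* y [ a + t ])
      ∎
    where
    open ≡-Reasoning
    entry : ∀ v → A[ G ] [ a ] (v ⊕ [ a ]) ≡ weight (toℕ v)
    entry v = cong (λ b → if b then 1ℚ else 0ℚ) (trans (Circ-band [ a ] (v ⊕ [ a ]))
                (cong (λ x → band (toℕ x)) (⊖-unique {v ⊕ [ a ]} {[ a ]} {v} refl)))
    vertex : ∀ v → v ⊕ [ a ] ≡ [ a + toℕ v ]
    vertex v = trans (⊕-comm v [ a ]) (trans (cong ([ a ] ⊕_) (sym ([toℕ] v))) (sym ([+] a (toℕ v))))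

  module _ (y : Fin n → ℚ) where

    Y : ℕ → ℚ
    Y a = y [ a ]

    open Windows k Y using (window)

    Y-periodic : Periodic n Y
    Y-periodic a = cong y (trans ([+] n a) (trans (cong (_⊕ [ a ]) [n]) (⊕-identityˡ [ a ])))

    row-windows : ∀ a → sumℚ (λ v → A[ G ] [ a ] v ℚ.* y v) ≡ window (suc a) ℚ.+ window (a + suc (k + g))
    row-windows a = begin
      sumℚ (λ v → A[ G ] [ a ] v ℚ.* y v)
        ≡⟨ row-sum y a ⟩
      ∑< n (λ t → weight t ℚ.* Y (a + t))
        ≡⟨ weighted-band-sum (λ t → Y (a + t)) ⟩
      ∑< k (λ i → Y (a + suc i)) ℚ.+ ∑< k (λ i → Y (a + suc (k + (g + i))))
        ≡⟨ cong₂ ℚ._+_ (∑<-cong k (λ {i} _ → cong Y (+-suc a i))) (∑<-cong k (λ {i} _ → cong Y (regroup i))) ⟩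
      window (suc a) ℚ.+ window (a + suc (k + g))
        ∎
      where
      open ≡-Reasoning
      regroup : ∀ i → a + suc (k + (g + i)) ≡ a + suc (k + g) + i
      regroup = solve 4 (λ a k g i → a :+ (con 1 :+ (k :+ (g :+ i)))
                                     := a :+ (con 1 :+ (k :+ g)) :+ i) refl a k g

    inKernel⇒recurrence : InKernel G y → ∀ a → window a ℚ.+ window (suc k + a) ≡ 0ℚ
    inKernel⇒recurrence y∈ker a = begin
      window a ℚ.+ window (suc k + a)                        ≡⟨ ℚ.+-comm (window a) _ ⟩
      window (suc k + a) ℚ.+ window a                        ≡⟨ cong (window (suc k + a) ℚ.+_) wrap ⟨
      window (suc (k + a)) ℚ.+ window (k + a + suc (k + g))  ≡⟨ row-windows (k + a) ⟨
      sumℚ (λ v → A[ G ] [ k + a ] v ℚ.* y v)                ≡⟨ y∈ker [ k + a ] ⟩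
      0ℚ                                                     ∎
      where
      open ≡-Reasoning
      around : ∀ s → k + a + suc (k + g) + s ≡ n + (a + s)
      around = solve 4 (λ k a g s → k :+ a :+ (con 1 :+ (k :+ g)) :+ s
                                    := con 1 :+ (k :+ (g :+ k)) :+ (a :+ s)) refl k a g
      wrap : window (k + a + suc (k + g)) ≡ window a
      wrap = ∑<-cong k (λ {s} _ → trans (cong Y (around s)) (Y-periodic (a + s)))

  module _ {j p : ℕ} (k≡j*2 : k ≡ j * 2) (0<j : 0 < j) (n≡p*2 : n ≡ p * 2)
           (coprime-suc-k : Coprime (suc k) p) (coprime-j : Coprime j p) where

    0<p : 0 < p
    0<p = n≢0⇒n>0 (λ p≡0 → 1+n≢0 (trans n≡p*2 (cong (_* 2) p≡0)))

    alternating-mod : ∀ a → alternating (a % n) ≡ alternating a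
    alternating-mod a = begin
      alternating (a % n)              ≡⟨ periodic-* alternating-periodic-n (a / n) (a % n) ⟨
      alternating (a / n * n + a % n)  ≡⟨ cong alternating (+-comm (a / n * n) (a % n)) ⟩
      alternating (a % n + a / n * n)  ≡⟨ cong alternating (m≡m%n+[m/n]*n a n) ⟨
      alternating a                    ∎
      where
      open ≡-Reasoning
      alternating-periodic-n : Periodic n alternating
      alternating-periodic-n = subst (λ m → Periodic m alternating) (sym n≡p*2) (periodic-* alternating-periodic p)

    alternating-window : ∀ b → ∑< k (λ s → alternating (b + s)) ≡ 0ℚ
    alternating-window b = begin
      ∑< k (λ s → alternating (b + s))
        ≡⟨ cong (λ m → ∑< m (λ s → alternating (b + s))) k≡j*2 ⟩
      ∑< (j * 2) (λ s → alternating (b + s))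
        ≡⟨ ∑<-2-periodic j (periodic-shift alternating-periodic b) ⟩
      j · (alternating (b + 0) ℚ.+ alternating (b + 1))
        ≡⟨ cong₂ (λ x y → j · (alternating x ℚ.+ alternating y)) (+-identityʳ b) (+-comm b 1) ⟩
      j · (alternating b ℚ.+ alternating (suc b))
        ≡⟨ cong (j ·_) (alternating-cancels b) ⟩
      j · 0ℚ
        ≡⟨ ·-zero j ⟩
      0ℚ
        ∎
      where open ≡-Reasoning

    alternating-vector : Fin n → ℚ
    alternating-vector v = alternating (toℕ v)

    alternating-inKernel : InKernel G alternating-vector
    alternating-inKernel u = begin
      sumℚ (λ v → A[ G ] u v ℚ.* alternating-vector v)
        ≡⟨ cong (λ w → sumℚ (λ v → A[ G ] w v ℚ.* alternating-vector v)) ([toℕ] u) ⟨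
      sumℚ (λ v → A[ G ] [ toℕ u ] v ℚ.* alternating-vector v)
        ≡⟨ row-windows alternating-vector (toℕ u) ⟩
      window (suc (toℕ u)) ℚ.+ window (toℕ u + suc (k + g))
        ≡⟨ cong₂ ℚ._+_ (vanishes (suc (toℕ u))) (vanishes (toℕ u + suc (k + g))) ⟩
      0ℚ
        ∎
      where
      open ≡-Reasoning
      open Windows k (Y alternating-vector) using (window)
      vanishes : ∀ b → window b ≡ 0ℚ
      vanishes b = trans (∑<-cong k (λ {s} _ → trans (cong alternating (toℕ-[] (b + s))) (alternating-mod (b + s))))
                         (alternating-window b)

    inKernel⇒alternating : ∀ y → InKernel G y → ∀ v → y v ≡ y zero ℚ.* alternating-vector v
    inKernel⇒alternating y y∈ker v = trans (cong y (sym ([toℕ] v)))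
      (Windows.Y-alternates k (Y y) (inKernel⇒recurrence y y∈ker) k≡j*2 0<j 0<p coprime-suc-k coprime-j
        (subst (λ m → Periodic m (Y y)) n≡p*2 (Y-periodic y)) (toℕ v))

    isNut : IsNut G
    isNut = subst (2 ≤_) (sym n≡p*2) (*-monoˡ-≤ 2 0<p) ,
            alternating-vector , alternating-inKernel , alternating-nonzero ∘ toℕ ,
            λ y y∈ker → y zero , inKernel⇒alternating y y∈ker

CayleyNutWithOrbits : ℕ → ℕ → Set
CayleyNutWithOrbits n k =
  IsCayley (Circ n (upToSet k)) × IsNut (Circ n (upToSet k)) ×
  EdgeOrbits (Circ n (upToSet k)) k × ArcOrbits (Circ n (upToSet k)) k

proposition1 : (k p : ℕ) → 2 ∣ k → 2 ≤ k → Prime p → k + 2 ≤ p →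
    IsCayley (Circ (2 * p) (upToSet k)) ×
    IsNut (Circ (2 * p) (upToSet k)) ×
    EdgeOrbits (Circ (2 * p) (upToSet k)) k ×
    ArcOrbits (Circ (2 * p) (upToSet k)) k
proposition1 k p (divides j k≡j*2) 2≤k p-prime k+2≤p with m≤n⇒∃[o]m+o≡n k+2≤p
... | e , refl = subst (λ n → CayleyNutWithOrbits n k) n≡2p
      (isCayley refl , isNut k≡j*2 0<j (trans n≡2p (*-comm 2 p)) suc-k⊥p j⊥p , edgeOrbits , arcOrbits)
  where
  open ℕ-Solver.+-*-Solver using (solve; _:+_; _:*_; _:=_; con)
  -- p = k + 2 + e, so 2p = 1 + k + g + k with the gap g = 2e + 3.
  g : ℕ
  g = 2 + suc (e + e)
  open BandOrbits k (suc (e + e)) using (edgeOrbits; arcOrbits)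
  open Band k g using (isCayley)
  open BandKernel k g using (isNut)
  n≡2p : suc (k + (g + k)) ≡ 2 * p
  n≡2p = solve 2 (λ k e → con 1 :+ (k :+ ((con 3 :+ (e :+ e)) :+ k)) := con 2 :* (k :+ con 2 :+ e)) refl k e
  0<j : 0 < j
  0<j = n≢0⇒n>0 λ { refl → <⇒≱ 2≤k (subst (_≤ 1) (sym k≡j*2) z≤n) }
  suc-k<p : suc k < p
  suc-k<p = subst (_≤ p) (+-comm k 2) k+2≤p
  j<p : j < p
  j<p = ≤-<-trans (subst (j ≤_) (sym k≡j*2) (m≤m*n j 2)) (<-trans (n<1+n k) suc-k<p)
  suc-k⊥p : Coprime (suc k) p
  suc-k⊥p = Coprimality.sym (prime⇒coprime p-prime suc-k<p)
  j⊥p : Coprime j p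
  j⊥p = Coprimality.sym (prime⇒coprime p-prime {{>-nonZero 0<j}} j<p)
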